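{- Let $t \geq 2$ be an integer and let $G$ be a $\{P_6, K_{2,t}\}$-free graph containing two nonadjacent vertices $a$ and $b$ such that $N_G(a)$ is an independent set of size at least $3(t-1)+1$ and every vertex of $N_G(a)$ lies on some induced path in $G$ with endpoints $a$ and $b$. Then $G$ contains, as an induced subgraph, a pyramid $\Pi$ with apex $a$ such that $b$ is $\Pi$-basic.
   Context: All graphs are finite and simple; $P_6$ is the path on $6$ vertices and $K_{2,t}$ the complete bipartite graph with parts of sizes $2$ and $t$; $\{P_6,K_{2,t}\}$-free means no induced subgraph isomorphic to either. A pyramid is the graph on vertices $a,x_1,x_2,x_3,y_1,y_2,y_3$ with edges $ax_i$, $x_iy_i$ ($i\in[3]$) and $y_iy_j$ ($i\neq j$); $a$ is its apex and $\{y_1,y_2,y_3\}$ its base. For an induced pyramid $\Pi$ of $G$, a vertex $v \in V(G)\setminus V(\Pi)$ is $\Pi$-basic if $N_G(v) \cap V(\Pi)$ equals the base of $\Pi$. -}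

module Defs where

open import Data.Nat using (ℕ; zero; suc; _+_; _*_; _∸_; _≡ᵇ_; _<ᵇ_)
open import Data.Fin using (Fin; zero; suc; toℕ; fromℕ)
open import Data.Bool.Properties using (∨-comm)
open import Data.Bool using (Bool; true; false; _∨_; _xor_)
open import Data.Product using (Σ; _×_; _,_; ∃)
open import Relation.Binary.PropositionalEquality using (_≡_; _≢_; refl)
open import Relation.Nullary using (¬_)
open import Function.Definitions using (Injective)

record Graph (n : ℕ) : Set where
  field
    adj    : Fin n → Fin n → Bool
    sym    : ∀ u v → adj u v ≡ adj v u
    irrefl : ∀ v → adj v v ≡ false
open Graph public

record InducedEmb {k n : ℕ} (H : Graph k) (G : Graph n) : Set where
  field
    map       : Fin k → Fin n
    injective : Injective _≡_ _≡_ map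
    preserves : ∀ i j → adj H i j ≡ adj G (map i) (map j)
open InducedEmb public

_⊑_ : {k n : ℕ} → Graph k → Graph n → Set
H ⊑ G = InducedEmb H G

Free : {k n : ℕ} → Graph k → Graph n → Set
Free H G = ¬ (H ⊑ G)

pathAdj : {m : ℕ} → Fin m → Fin m → Bool
pathAdj i j = ((toℕ i + 1) ≡ᵇ toℕ j) ∨ ((toℕ j + 1) ≡ᵇ toℕ i)

private
  n+1≢n : ∀ n → ((n + 1) ≡ᵇ n) ≡ false
  n+1≢n zero    = refl
  n+1≢n (suc n) = n+1≢n n

  ∨-false : ∀ {x} → x ≡ false → (x ∨ x) ≡ false
  ∨-false refl = refl

  xor-comm : ∀ x y → (x xor y) ≡ (y xor x)
  xor-comm true  true  = refl
  xor-comm true  false = refl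
  xor-comm false true  = refl
  xor-comm false false = refl

  xor-self : ∀ x → (x xor x) ≡ false
  xor-self true  = refl
  xor-self false = refl

Path : (m : ℕ) → Graph m
Path m = record
  { adj    = pathAdj
  ; sym    = λ u v → ∨-comm (((toℕ u + 1) ≡ᵇ toℕ v)) (((toℕ v + 1) ≡ᵇ toℕ u))
  ; irrefl = λ v → ∨-false (n+1≢n (toℕ v))
  }

P₆ : Graph 6
P₆ = Path 6

-- K_{2,t} on vertices 0,…,t+1; parts {0,1} and {2,…,t+1}

side : {m : ℕ} → Fin m → Bool
side i = toℕ i <ᵇ 2

K₂ : (t : ℕ) → Graph (2 + t)
K₂ t = record
  { adj    = λ u v → side u xor side v
  ; sym    = λ u v → xor-comm (side u) (side v)
  ; irrefl = λ v → xor-self (side v)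
  }

-- The pyramid on Fin 7:  0 = apex a;  1,2,3 = x₁,x₂,x₃;  4,5,6 = y₁,y₂,y₃.
-- Edges a xᵢ, xᵢ yᵢ (i ∈ [3]) and yᵢ yⱼ (i ≠ j).

pyrEdge : ℕ → ℕ → Bool
pyrEdge 0 1 = true
pyrEdge 0 2 = true
pyrEdge 0 3 = true
pyrEdge 1 4 = true
pyrEdge 2 5 = true
pyrEdge 3 6 = true
pyrEdge 4 5 = true
pyrEdge 4 6 = true
pyrEdge 5 6 = true
pyrEdge _ _ = false

pyrAdj : Fin 7 → Fin 7 → Bool
pyrAdj i j = pyrEdge (toℕ i) (toℕ j) ∨ pyrEdge (toℕ j) (toℕ i)

private
  pyrIrrefl : ∀ v → pyrAdj v v ≡ false
  pyrIrrefl zero = refl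
  pyrIrrefl (suc zero) = refl
  pyrIrrefl (suc (suc zero)) = refl
  pyrIrrefl (suc (suc (suc zero))) = refl
  pyrIrrefl (suc (suc (suc (suc zero)))) = refl
  pyrIrrefl (suc (suc (suc (suc (suc zero))))) = refl
  pyrIrrefl (suc (suc (suc (suc (suc (suc zero)))))) = refl

Pyramid : Graph 7
Pyramid = record
  { adj    = pyrAdj
  ; sym    = λ u v → ∨-comm (pyrEdge (toℕ u) (toℕ v)) (pyrEdge (toℕ v) (toℕ u))
  ; irrefl = pyrIrrefl
  }

apex : Fin 7
apex = zero

inBase : Fin 7 → Bool
inBase i = 3 <ᵇ toℕ i

NeighbourhoodIndependent : {n : ℕ} → Graph n → Fin n → Set
NeighbourhoodIndependent G a =
  ∀ x y → adj G a x ≡ true → adj G a y ≡ true → adj G x y ≡ false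

DegreeAtLeast : {n : ℕ} → Graph n → Fin n → ℕ → Set
DegreeAtLeast {n} G a m =
  Σ (Fin m → Fin n) λ g → Injective _≡_ _≡_ g × (∀ i → adj G a (g i) ≡ true)

OnInducedPath : {n : ℕ} → Graph n → Fin n → Fin n → Fin n → Set
OnInducedPath G a b v =
  Σ ℕ λ k → Σ (Path (suc k) ⊑ G) λ P →
    (map P zero ≡ a) × (map P (fromℕ k) ≡ b) × (∃ λ i → map P i ≡ v)

-- Π is an induced pyramid of G with apex a (Π given as an induced copy)
-- and b ∉ V(Π) is Π-basic: N_G(b) ∩ V(Π) is exactly the base.
Basic : {n : ℕ} → (G : Graph n) → Pyramid ⊑ G → Fin n → Set
Basic G Π b = (∀ i → map Π i ≢ b) × (∀ i → adj G b (map Π i) ≡ inBase i)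

module Submission where

-- Write X = N(a) ∖ N(b). Every x ∈ X has a neighbour in N(b) ∖ N(a): on an induced a–b path through x,
-- x is the second vertex, and a path with five or more vertices would contain an induced P₄ x–p–q–r with
-- p, q, r ∉ N[a]. Such P₄'s do not exist: as N(a) is independent and G is K_{2,t}-free, a vertex outside
-- N[a] has at most t − 1 neighbours in N(a), so some neighbour x′ of a misses p, q and r, and
-- x′–a–x–p–q–r is an induced P₆. Now take an inclusion-minimal Y ⊆ N(b) ∖ N(a) dominating X, so that
-- every y ∈ Y has a private neighbour x_y ∈ X. The same count yields three distinct y₁, y₂, y₃ ∈ Y; they
-- are pairwise adjacent, for otherwise x_{yᵢ}–yᵢ–b–yⱼ is a forbidden P₄. Hence a, the x_{yᵢ} and the yᵢ
-- form a pyramid of which b is a basic vertex.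

open import Defs hiding (sym)
open import Data.Nat using (ℕ; zero; suc; _+_; _*_; _∸_; _≤_; _<_; s≤s; _≡ᵇ_)
open import Data.Nat.Properties using (+-suc; +-mono-≤; +-identityʳ; m≤m+n; m+1+n≰m; _≤?_; ≰⇒>)
open import Data.Fin using (Fin; zero; suc; Fin′; inject; inject≤; fromℕ; compare; less; equal; greater; _≟_)
open import Data.Fin.Patterns using (0F; 1F; 2F; 3F; 4F; 5F; 6F)
open import Data.Fin.Properties using (all?; any?; ¬∀⟶∃¬; suc-injective; inject≤-injective; toℕ-inject≤)
open import Data.Fin.Subset using (Subset; ⊤; _∈_; _-_; _⊂_)
open import Data.Fin.Subset.Properties using (_∈?_; ∈⊤; x∈p∧x≢y⇒x∈p-y; x∈p⇒p-x⊂p)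
open import Data.Fin.Subset.Induction using (⊂-wellFounded)
open import Data.Vec.Functional using (_∷_; [])
open import Data.Bool using (true; false; _∨_)
open import Data.Bool.Properties using (¬-not; not-¬) renaming (_≟_ to _≟ᵇ_)
open import Data.Product using (Σ; _×_; _,_; proj₁; proj₂; ∃; ∃₂)
open import Data.Sum using (_⊎_; inj₁; inj₂)
open import Data.Empty using (⊥; ⊥-elim)
open import Function using (_∘_; case_of_)
open import Function.Definitions using (Injective)
import Function.Construct.Composition as Compose
open import Induction.WellFounded using (Acc; acc)
open import Relation.Nullary using (¬_; Dec; yes; no)
open import Relation.Nullary.Decidable using (_×-dec_; _→-dec_; from-yes)
open import Relation.Binary.PropositionalEquality
  using (_≡_; _≢_; refl; sym; trans; cong; cong₂; subst; ≢-sym)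

private
  variable
    k m n r s : ℕ

-- Induced embeddings

Preserves : (H : Graph k) (G : Graph n) → (Fin k → Fin n) → Set
Preserves H G f = ∀ i j → adj H i j ≡ adj G (f i) (f j)

TwinFree : Graph k → Set
TwinFree H = ∀ i j → (∀ l → adj H i l ≡ adj H j l) → i ≡ j

twinFree? : (H : Graph k) → Dec (TwinFree H)
twinFree? H = all? λ i → all? λ j → all? (λ l → adj H i l ≟ᵇ adj H j l) →-dec (i ≟ j)

P₆-twinFree : TwinFree P₆
P₆-twinFree = from-yes (twinFree? P₆)

P₄-twinFree : TwinFree (Path 4)
P₄-twinFree = from-yes (twinFree? (Path 4))

Pyramid-twinFree : TwinFree Pyramid
Pyramid-twinFree = from-yes (twinFree? Pyramid)

twinFree-embedding : {H : Graph k} {G : Graph n} → TwinFree H →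
  (f : Fin k → Fin n) → Preserves H G f → H ⊑ G
twinFree-embedding {H = H} {G} twinFree f pres = record
  { map       = f
  ; injective = λ {i} {j} fi≡fj → twinFree i j λ l →
      trans (pres i l) (trans (cong (λ u → adj G u (f l)) fi≡fj) (sym (pres j l)))
  ; preserves = pres
  }

preserves-fromAboveDiagonal : {H : Graph k} {G : Graph n} {f : Fin k → Fin n} →
  (∀ j (i : Fin′ j) → adj G (f (inject i)) (f j) ≡ adj H (inject i) j) →
  Preserves H G f
preserves-fromAboveDiagonal {H = H} {G} {f} above i j with compare i j
... | less j′ i′    = sym (above j′ i′)
... | equal i       = trans (irrefl H i) (sym (irrefl G (f i)))
... | greater i′ j′ = trans (Graph.sym H i′ (inject j′))
                        (trans (sym (above i′ j′)) (Graph.sym G (f (inject j′)) (f i′)))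

⊑-trans : {K : Graph m} {H : Graph k} {G : Graph n} → K ⊑ H → H ⊑ G → K ⊑ G
⊑-trans e e′ = record
  { map       = map e′ ∘ map e
  ; injective = Compose.injective _≡_ _≡_ _≡_ (injective e) (injective e′)
  ; preserves = λ i j → trans (preserves e i j) (preserves e′ (map e i) (map e j))
  }

Path-suc : Path m ⊑ Path (suc m)
Path-suc = record { map = suc ; injective = suc-injective ; preserves = λ _ _ → refl }

Path-inject≤ : m ≤ k → Path m ⊑ Path k
Path-inject≤ m≤k = record
  { map       = λ i → inject≤ i m≤k
  ; injective = inject≤-injective m≤k m≤k _ _
  ; preserves = λ i j → sym (cong₂ (λ p q → ((p + 1) ≡ᵇ q) ∨ ((q + 1) ≡ᵇ p))
                                    (toℕ-inject≤ i m≤k) (toℕ-inject≤ j m≤k))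
  }

module _ (G : Graph n) where

  single-preserves : ∀ w → Preserves (Path 1) G (w ∷ [])
  single-preserves w 0F 0F = sym (irrefl G w)

  cons-preserves : ∀ {f : Fin (suc m) → Fin n} {w} → Preserves (Path (suc m)) G f →
    adj G w (f 0F) ≡ true → (∀ i → adj G w (f (suc i)) ≡ false) →
    Preserves (Path (suc (suc m))) G (w ∷ f)
  cons-preserves {f = f} {w} pres w∼f₀ w≁f = go
    where
    go : Preserves (Path (suc (suc _))) G (w ∷ f)
    go 0F            0F            = sym (irrefl G w)
    go 0F            1F            = sym w∼f₀
    go 0F            (suc (suc j)) = sym (w≁f j)
    go 1F            0F            = trans (sym w∼f₀) (Graph.sym G w (f 0F))
    go (suc (suc i)) 0F            = trans (sym (w≁f i)) (Graph.sym G w (f (suc i)))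
    go (suc i)       (suc j)       = pres i j

-- Counting injective families

Family : {A : Set} → (A → Set) → ℕ → Set
Family {A} P k = Σ (Fin k → A) λ e → Injective _≡_ _≡_ e × (∀ i → P (e i))

AtMost : {A : Set} → (A → Set) → ℕ → Set
AtMost P s = ∀ {k} → Family P k → k ≤ s

family-∘ : {A B : Set} {P : A → Set} (f : B → A) → Injective _≡_ _≡_ f →
  Family (P ∘ f) k → Family P k
family-∘ f f-inj (e , e-inj , eP) =
  f ∘ e , Compose.injective _≡_ _≡_ _≡_ e-inj f-inj , eP

family-empty : {P : Fin m → Set} → Family P 0
family-empty = (λ ()) , (λ { {()} }) , (λ ())

family-cons : {P : Fin (suc m) → Set} → P zero → Family (P ∘ suc) k → Family P (suc k)
family-cons P₀ (e , e-inj , eP) = zero ∷ suc ∘ e , inj , λ { 0F → P₀ ; (suc i) → eP i }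
  where
  inj : Injective _≡_ _≡_ (zero ∷ suc ∘ e)
  inj {zero}  {zero}  _  = refl
  inj {suc i} {suc j} eq = cong suc (e-inj (suc-injective eq))

partition : {P Q : Fin m → Set} → (∀ i → P i ⊎ Q i) →
  ∃₂ λ k l → m ≡ k + l × Family P k × Family Q l
partition {zero} {P} {Q} _ = 0 , 0 , refl , family-empty {P = P} , family-empty {P = Q}
partition {suc m} {P} {Q} P⊎Q with partition {P = P ∘ suc} {Q ∘ suc} (P⊎Q ∘ suc) | P⊎Q zero
... | k , l , eq , Ps , Qs | inj₁ P₀ =
  suc k , l , cong suc eq , family-cons {P = P} P₀ Ps , family-∘ {P = Q} suc suc-injective Qs
... | k , l , eq , Ps , Qs | inj₂ Q₀ =
  k , suc l , trans (cong suc eq) (sym (+-suc k l)) ,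
  family-∘ {P = P} suc suc-injective Ps , family-cons {P = Q} Q₀ Qs

AtMost-⊎ : {A : Set} {P Q : A → Set} → AtMost P s → AtMost Q r → AtMost (λ y → P y ⊎ Q y) (s + r)
AtMost-⊎ {s = s} {r} {P = P} {Q} P≤s Q≤r (e , e-inj , eP⊎Q)
  with partition {P = P ∘ e} {Q ∘ e} eP⊎Q
... | k , l , eq , Ps , Qs = subst (_≤ s + r) (sym eq)
  (+-mono-≤ (P≤s (family-∘ {P = P} e e-inj Ps)) (Q≤r (family-∘ {P = Q} e e-inj Qs)))

-- Minimal dominating sets

module _ {ℓ} {P : Subset n → Set ℓ} (P? : ∀ S → Dec (P S)) where

  minimal : ∀ S → P S → ∃ λ S′ → P S′ × (∀ {v} → v ∈ S′ → ¬ P (S′ - v))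
  minimal S = go S (⊂-wellFounded S)
    where
    go : ∀ S → Acc _⊂_ S → P S → ∃ λ S′ → P S′ × (∀ {v} → v ∈ S′ → ¬ P (S′ - v))
    go S (acc smaller) PS with any? (λ v → (v ∈? S) ×-dec P? (S - v))
    ... | yes (v , v∈S , PS-v) = go (S - v) (smaller (x∈p⇒p-x⊂p v∈S)) PS-v
    ... | no ¬removable        = S , PS , λ v∈S PS-v → ¬removable (_ , v∈S , PS-v)

module Domination {X : Fin n → Set} (X? : ∀ x → Dec (X x))
                  {D : Fin n → Fin n → Set} (D? : ∀ x y → Dec (D x y)) where

  Dominates : Subset n → Set
  Dominates S = ∀ x → X x → ∃ λ y → y ∈ S × D x y

  dominates? : ∀ S → Dec (Dominates S)
  dominates? S = all? λ x → X? x →-dec any? λ y → (y ∈? S) ×-dec D? x y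

  record PrivateNeighbour (S : Subset n) (v : Fin n) : Set where
    field
      vertex    : Fin n
      in-X      : X vertex
      dominated : D vertex v
      exclusive : ∀ {w} → w ∈ S → w ≢ v → ¬ D vertex w

  privateNeighbour : ∀ {S v} → Dominates S → ¬ Dominates (S - v) → PrivateNeighbour S v
  privateNeighbour {S} {v} dom ¬dom-v
    with ¬∀⟶∃¬ n _ (λ x → X? x →-dec any? (λ y → (y ∈? (S - v)) ×-dec D? x y)) ¬dom-v
  ... | x , ¬dominated with X? x
  ...   | no ¬Xx = ⊥-elim (¬dominated (⊥-elim ∘ ¬Xx))
  ...   | yes Xx = record { vertex = x ; in-X = Xx ; dominated = Dxv ; exclusive = exclusive }
    where
    exclusive : ∀ {w} → w ∈ S → w ≢ v → ¬ D x w
    exclusive w∈S w≢v Dxw = ¬dominated λ _ → _ , x∈p∧x≢y⇒x∈p-y w∈S w≢v , Dxw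
    Dxv : D x v
    Dxv with dom x Xx
    ... | y , y∈S , Dxy with y ≟ v
    ...   | yes refl = Dxy
    ...   | no y≢v   = ⊥-elim (exclusive y∈S y≢v Dxy)

  minimalDominating : ∀ S → Dominates S →
    ∃ λ S′ → Dominates S′ × (∀ {v} → v ∈ S′ → PrivateNeighbour S′ v)
  minimalDominating S dom with minimal dominates? S dom
  ... | S′ , dom′ , irredundant = S′ , dom′ , λ v∈S′ → privateNeighbour dom′ (irredundant v∈S′)

-- Pyramids from their adjacency pattern

module _ (G : Graph n) where

  record PyramidShape (a : Fin n) (x y : Fin 3 → Fin n) : Set where
    field
      a∼x : ∀ i → adj G a (x i) ≡ true
      a≁y : ∀ i → adj G a (y i) ≡ false
      x∼y : ∀ i → adj G (x i) (y i) ≡ true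
      x≁y : ∀ {i j} → i ≢ j → adj G (x i) (y j) ≡ false
      x≁x : ∀ i j → adj G (x i) (x j) ≡ false
      y∼y : ∀ {i j} → i ≢ j → adj G (y i) (y j) ≡ true

  pyramidVertex : Fin n → (Fin 3 → Fin n) → (Fin 3 → Fin n) → Fin 7 → Fin n
  pyramidVertex a x y = a ∷ x 0F ∷ x 1F ∷ x 2F ∷ y 0F ∷ y 1F ∷ y 2F ∷ []

  module _ {a x y} (shape : PyramidShape a x y) where
    open PyramidShape shape

    shape⇒⊑ : Pyramid ⊑ G
    shape⇒⊑ = twinFree-embedding Pyramid-twinFree (pyramidVertex a x y)
                (preserves-fromAboveDiagonal {H = Pyramid} {G} above)
      where
      above : ∀ j (i : Fin′ j) → adj G (pyramidVertex a x y (inject i)) (pyramidVertex a x y j)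
                                   ≡ adj Pyramid (inject i) j
      above 0F ()
      above 1F 0F = a∼x 0F
      above 2F 0F = a∼x 1F
      above 2F 1F = x≁x 0F 1F
      above 3F 0F = a∼x 2F
      above 3F 1F = x≁x 0F 2F
      above 3F 2F = x≁x 1F 2F
      above 4F 0F = a≁y 0F
      above 4F 1F = x∼y 0F
      above 4F 2F = x≁y {1F} {0F} λ ()
      above 4F 3F = x≁y {2F} {0F} λ ()
      above 5F 0F = a≁y 1F
      above 5F 1F = x≁y {0F} {1F} λ ()
      above 5F 2F = x∼y 1F
      above 5F 3F = x≁y {2F} {1F} λ ()
      above 5F 4F = y∼y {0F} {1F} λ ()
      above 6F 0F = a≁y 2F
      above 6F 1F = x≁y {0F} {2F} λ ()
      above 6F 2F = x≁y {1F} {2F} λ ()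
      above 6F 3F = x∼y 2F
      above 6F 4F = y∼y {0F} {2F} λ ()
      above 6F 5F = y∼y {1F} {2F} λ ()

    shape-basic : ∀ {b} → b ≢ a → adj G b a ≡ false →
      (∀ i → adj G b (x i) ≡ false) → (∀ i → adj G b (y i) ≡ true) → Basic G shape⇒⊑ b
    shape-basic {b} b≢a b≁a b≁x b∼y = distinct , neighbours
      where
      x≢b : ∀ i → x i ≢ b
      x≢b i refl = case trans (sym b≁a) (trans (Graph.sym G b a) (a∼x i)) of λ ()
      y≢b : ∀ i → y i ≢ b
      y≢b i refl = case trans (sym (b∼y i)) (irrefl G b) of λ ()
      distinct : ∀ i → pyramidVertex a x y i ≢ b
      distinct 0F = ≢-sym b≢a
      distinct 1F = x≢b 0F
      distinct 2F = x≢b 1F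
      distinct 3F = x≢b 2F
      distinct 4F = y≢b 0F
      distinct 5F = y≢b 1F
      distinct 6F = y≢b 2F
      neighbours : ∀ i → adj G b (pyramidVertex a x y i) ≡ inBase i
      neighbours 0F = b≁a
      neighbours 1F = b≁x 0F
      neighbours 2F = b≁x 1F
      neighbours 3F = b≁x 2F
      neighbours 4F = b∼y 0F
      neighbours 5F = b∼y 1F
      neighbours 6F = b∼y 2F

-- The neighbourhood of a

module _ (G : Graph n) where

  adj-sym : ∀ {u v c} → adj G u v ≡ c → adj G v u ≡ c
  adj-sym {u} {v} = trans (Graph.sym G v u)

  adj-cong : ∀ {u u′ v v′ c} → u ≡ u′ → v ≡ v′ → adj G u v ≡ c → adj G u′ v′ ≡ c
  adj-cong refl refl uv = uv

  edge : (P : Path k ⊑ G) → ∀ i j → adj G (map P i) (map P j) ≡ pathAdj i j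
  edge P i j = sym (preserves P i j)

  Far : Fin n → Fin n → Set
  Far a u = adj G a u ≡ false × u ≢ a

  CommonNeighbour : Fin n → Fin n → Fin n → Set
  CommonNeighbour a z y = adj G a y ≡ true × adj G z y ≡ true

  module _ {a} (independent : NeighbourhoodIndependent G a) where

    K₂-embedding : ∀ {t z} → Far a z → (h : Fin t → Fin n) → Injective _≡_ _≡_ h →
      (∀ i → CommonNeighbour a z (h i)) → K₂ t ⊑ G
    K₂-embedding {t} {z} (a≁z , z≢a) h h-inj common =
      record { map = f ; injective = inj ; preserves = pres }
      where
      f : Fin (2 + t) → Fin n
      f = a ∷ z ∷ h
      a∼h : ∀ i → adj G a (h i) ≡ true
      a∼h = proj₁ ∘ common
      z∼h : ∀ i → adj G z (h i) ≡ true
      z∼h = proj₂ ∘ common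
      h≢ : ∀ {u} i → adj G u (h i) ≡ true → h i ≢ u
      h≢ {u} i u∼h refl = case trans (sym u∼h) (irrefl G u) of λ ()
      pres : Preserves (K₂ t) G f
      pres 0F            0F            = sym (irrefl G a)
      pres 0F            1F            = sym a≁z
      pres 0F            (suc (suc j)) = sym (a∼h j)
      pres 1F            0F            = sym (adj-sym a≁z)
      pres 1F            1F            = sym (irrefl G z)
      pres 1F            (suc (suc j)) = sym (z∼h j)
      pres (suc (suc i)) 0F            = sym (adj-sym (a∼h i))
      pres (suc (suc i)) 1F            = sym (adj-sym (z∼h i))
      pres (suc (suc i)) (suc (suc j)) = sym (independent (h i) (h j) (a∼h i) (a∼h j))
      inj : Injective _≡_ _≡_ f
      inj {0F}          {0F}          _  = refl
      inj {0F}          {1F}          eq = ⊥-elim (z≢a (sym eq))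
      inj {0F}          {suc (suc j)} eq = ⊥-elim (h≢ j (a∼h j) (sym eq))
      inj {1F}          {0F}          eq = ⊥-elim (z≢a eq)
      inj {1F}          {1F}          _  = refl
      inj {1F}          {suc (suc j)} eq = ⊥-elim (h≢ j (z∼h j) (sym eq))
      inj {suc (suc i)} {0F}          eq = ⊥-elim (h≢ i (a∼h i) eq)
      inj {suc (suc i)} {1F}          eq = ⊥-elim (h≢ i (z∼h i) eq)
      inj {suc (suc i)} {suc (suc j)} eq = cong (λ i → suc (suc i)) (h-inj eq)

    commonNeighbours-atMost : ∀ {t z} → Free (K₂ t) G → Far a z →
      AtMost (CommonNeighbour a z) (t ∸ 1)
    commonNeighbours-atMost {t} K-free far {k} (h , h-inj , common) with t ≤? k
    ... | yes t≤k = ⊥-elim (K-free (K₂-embedding far (λ i → h (inject≤ i t≤k))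
                     (λ eq → inject≤-injective t≤k t≤k _ _ (h-inj eq)) (λ i → common _)))
    ... | no t≰k  = pred-bound (≰⇒> t≰k)
      where
      pred-bound : ∀ {t} → k < t → k ≤ t ∸ 1
      pred-bound (s≤s k≤t) = k≤t

    module _ {t} (K-free : Free (K₂ t) G) where

      neighbour-avoiding : ∀ {u v w} → DegreeAtLeast G a (3 * (t ∸ 1) + 1) → Far a u → Far a v → Far a w →
        ∃ λ x → adj G a x ≡ true × adj G u x ≡ false × adj G v x ≡ false × adj G w x ≡ false
      neighbour-avoiding {u} {v} {w} (g , g-injective , a∼g) far-u far-v far-w
        with any? (λ i → (adj G u (g i) ≟ᵇ false) ×-dec
                         ((adj G v (g i) ≟ᵇ false) ×-dec (adj G w (g i) ≟ᵇ false)))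
      ...   | yes (i , avoids) = g i , a∼g i , avoids
      ...   | no ¬avoids       = ⊥-elim (m+1+n≰m (3 * (t ∸ 1))
                                   (subst (3 * (t ∸ 1) + 1 ≤_) (cong (λ p → t ∸ 1 + (t ∸ 1 + p))
                                     (sym (+-identityʳ (t ∸ 1)))) counted))
        where
        covered : ∀ i → CommonNeighbour a u (g i) ⊎ CommonNeighbour a v (g i) ⊎ CommonNeighbour a w (g i)
        covered i with adj G u (g i) in u∼g | adj G v (g i) in v∼g | adj G w (g i) in w∼g
        ... | true  | _     | _     = inj₁ (a∼g i , refl)
        ... | false | true  | _     = inj₂ (inj₁ (a∼g i , refl))
        ... | false | false | true  = inj₂ (inj₂ (a∼g i , refl))
        ... | false | false | false = ⊥-elim (¬avoids (i , u∼g , v∼g , w∼g))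
        counted : 3 * (t ∸ 1) + 1 ≤ t ∸ 1 + (t ∸ 1 + (t ∸ 1))
        counted = AtMost-⊎ {P = CommonNeighbour a u} {λ y → CommonNeighbour a v y ⊎ CommonNeighbour a w y}
                    (commonNeighbours-atMost K-free far-u)
                    (AtMost-⊎ {P = CommonNeighbour a v} {CommonNeighbour a w}
                      (commonNeighbours-atMost K-free far-v) (commonNeighbours-atMost K-free far-w))
                    (g , g-injective , covered)

      module _ (degree : DegreeAtLeast G a (3 * (t ∸ 1) + 1)) (P₆-free : Free P₆ G) where

        no-far-P₄ : (P : Path 4 ⊑ G) → adj G a (map P 0F) ≡ true → (∀ i → Far a (map P (suc i))) → ⊥
        no-far-P₄ P a∼P₀ far with neighbour-avoiding degree (far 0F) (far 1F) (far 2F)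
        ... | x , a∼x , P₁≁x , P₂≁x , P₃≁x = P₆-free (twinFree-embedding P₆-twinFree (x ∷ a ∷ map P)
              (cons-preserves G (cons-preserves G (preserves P) a∼P₀ (proj₁ ∘ far)) (adj-sym a∼x) x≁P))
          where
          x≁P : ∀ i → adj G x (map P i) ≡ false
          x≁P 0F = independent x (map P 0F) a∼x a∼P₀
          x≁P 1F = adj-sym P₁≁x
          x≁P 2F = adj-sym P₂≁x
          x≁P 3F = adj-sym P₃≁x

        module _ {b} (a≁b : adj G a b ≡ false) where

          Exclusive : Fin n → Set
          Exclusive x = adj G a x ≡ true × adj G b x ≡ false

          -- Restricting the dominating vertices to N(b) ∖ N(a) is part of Link, so that the whole vertex
          -- set is a dominating set to start from.
          Link : Fin n → Fin n → Set
          Link x y = adj G x y ≡ true × adj G b y ≡ true × adj G a y ≡ false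

          secondVertex-link : ∀ k (P : Path (suc k) ⊑ G) → map P 0F ≡ a → map P (fromℕ k) ≡ b →
            ∀ i → pathAdj 0F i ≡ true → adj G b (map P i) ≡ false → ∃ (Link (map P i))
          secondVertex-link _       _ _ _ 0F            () _
          secondVertex-link (suc _) _ _ _ (suc (suc _)) () _
          secondVertex-link 1 P P₀≡a P₁≡b 1F _ _ =
            ⊥-elim (not-¬ (adj-cong P₀≡a P₁≡b (edge P 0F 1F)) a≁b)
          secondVertex-link 2 P P₀≡a P₂≡b 1F _ b≁P₁ =
            ⊥-elim (not-¬ (adj-cong refl P₂≡b (edge P 1F 2F)) (adj-sym b≁P₁))
          secondVertex-link 3 P P₀≡a P₃≡b 1F _ _ =
            map P 2F , edge P 1F 2F , adj-sym (adj-cong refl P₃≡b (edge P 2F 3F)) ,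
            adj-cong P₀≡a refl (edge P 0F 2F)
          secondVertex-link (suc (suc (suc (suc k)))) P P₀≡a _ 1F _ _ =
            ⊥-elim (no-far-P₄ window (adj-cong P₀≡a refl (edge P 0F 1F)) far)
            where
            window : Path 4 ⊑ G
            window = ⊑-trans (⊑-trans (Path-inject≤ (m≤m+n 4 k)) Path-suc) P
            far : ∀ i → Far a (map window (suc i))
            far i = adj-cong P₀≡a refl (edge P 0F _) ,
                    λ Pᵢ≡a → case injective P (trans Pᵢ≡a (sym P₀≡a)) of λ ()

          exclusive-link : ∀ {x} → Exclusive x → OnInducedPath G a b x → ∃ (Link x)
          exclusive-link (a∼x , b≁x) (k , P , P₀≡a , Pₖ≡b , i , refl) =
            secondVertex-link k P P₀≡a Pₖ≡b i
              (trans (preserves P 0F i) (adj-cong (sym P₀≡a) refl a∼x)) b≁x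

          module Construction (a≢b : a ≢ b) where

            open Domination {X = Exclusive} (λ x → (adj G a x ≟ᵇ true) ×-dec (adj G b x ≟ᵇ false))
                            {D = Link} (λ x y → (adj G x y ≟ᵇ true) ×-dec
                                                ((adj G b y ≟ᵇ true) ×-dec (adj G a y ≟ᵇ false)))
              public

            far-b : Far a b
            far-b = a≁b , ≢-sym a≢b

            ⊤-dominates : (∀ v → adj G a v ≡ true → OnInducedPath G a b v) → Dominates ⊤
            ⊤-dominates paths x exclusive@(a∼x , _) with exclusive-link exclusive (paths x a∼x)
            ... | y , link = y , ∈⊤ , link

            module _ {S} (S-dominates : Dominates S)
                     (S-private : ∀ {v} → v ∈ S → PrivateNeighbour S v) where

              open PrivateNeighbour

              linked : ∀ {v} → v ∈ S → adj G b v ≡ true × adj G a v ≡ false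
              linked = proj₂ ∘ dominated ∘ S-private

              S-far : ∀ {v} → v ∈ S → Far a v
              S-far v∈S with linked v∈S
              ... | b∼v , a≁v = a≁v , λ { refl → not-¬ b∼v (adj-sym a≁b) }

              spoke : ∀ {v} → v ∈ S → Fin n
              spoke = vertex ∘ S-private

              spoke-exclusive : ∀ {v} (v∈S : v ∈ S) → Exclusive (spoke v∈S)
              spoke-exclusive = in-X ∘ S-private

              spoke∼ : ∀ {v} (v∈S : v ∈ S) → adj G (spoke v∈S) v ≡ true
              spoke∼ = proj₁ ∘ dominated ∘ S-private

              spoke≁ : ∀ {v w} (v∈S : v ∈ S) → w ∈ S → w ≢ v → adj G (spoke v∈S) w ≡ false
              spoke≁ v∈S w∈S w≢v =
                ¬-not λ spoke∼w → exclusive (S-private v∈S) w∈S w≢v (spoke∼w , linked w∈S)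

              S-adjacent : ∀ {v w} → v ∈ S → w ∈ S → v ≢ w → adj G v w ≡ true
              S-adjacent {v} {w} v∈S w∈S v≢w with adj G v w in v≁w
              ... | true  = refl
              ... | false = ⊥-elim (no-far-P₄ P₄ (proj₁ (spoke-exclusive v∈S))
                              λ { 0F → S-far v∈S ; 1F → far-b ; 2F → S-far w∈S })
                where
                P₄ : Path 4 ⊑ G
                P₄ = twinFree-embedding P₄-twinFree (spoke v∈S ∷ v ∷ b ∷ w ∷ [])
                       (cons-preserves G
                         (cons-preserves G
                           (cons-preserves G (single-preserves G w) (proj₁ (linked w∈S)) λ ())
                           (adj-sym (proj₁ (linked v∈S))) λ { 0F → v≁w })
                         (spoke∼ v∈S)
                         λ { 0F → adj-sym (proj₂ (spoke-exclusive v∈S))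
                           ; 1F → spoke≁ v∈S w∈S (≢-sym v≢w) })

              fresh : ∀ {u w} → Far a u → Far a w → ∃ λ v → v ∈ S × v ≢ u × v ≢ w
              fresh far-u far-w with neighbour-avoiding degree far-b far-u far-w
              ... | y , a∼y , b≁y , u≁y , w≁y with S-dominates y (a∼y , b≁y)
              ... | v , v∈S , y∼v , _ =
                v , v∈S , (λ { refl → not-¬ y∼v (adj-sym u≁y) }) , (λ { refl → not-¬ y∼v (adj-sym w≁y) })

              three-in-S : ∃ λ (y : Fin 3 → Fin n) → Injective _≡_ _≡_ y × (∀ i → y i ∈ S)
              three-in-S with fresh far-b far-b
              ... | v₁ , v₁∈S , _ with fresh (S-far v₁∈S) (S-far v₁∈S)
              ... | v₂ , v₂∈S , v₂≢v₁ , _ with fresh (S-far v₁∈S) (S-far v₂∈S)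
              ... | v₃ , v₃∈S , v₃≢v₁ , v₃≢v₂ =
                v₁ ∷ v₂ ∷ v₃ ∷ [] , inj , λ { 0F → v₁∈S ; 1F → v₂∈S ; 2F → v₃∈S }
                where
                inj : Injective _≡_ _≡_ (v₁ ∷ v₂ ∷ v₃ ∷ [])
                inj {0F} {0F} _  = refl
                inj {0F} {1F} eq = ⊥-elim (v₂≢v₁ (sym eq))
                inj {0F} {2F} eq = ⊥-elim (v₃≢v₁ (sym eq))
                inj {1F} {0F} eq = ⊥-elim (v₂≢v₁ eq)
                inj {1F} {1F} _  = refl
                inj {1F} {2F} eq = ⊥-elim (v₃≢v₂ (sym eq))
                inj {2F} {0F} eq = ⊥-elim (v₃≢v₁ eq)
                inj {2F} {1F} eq = ⊥-elim (v₃≢v₂ eq)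
                inj {2F} {2F} _  = refl

              module _ {y : Fin 3 → Fin n} (y-injective : Injective _≡_ _≡_ y) (y∈S : ∀ i → y i ∈ S) where

                x : Fin 3 → Fin n
                x i = spoke (y∈S i)

                shape : PyramidShape G a x y
                shape = record
                  { a∼x = λ i → proj₁ (spoke-exclusive (y∈S i))
                  ; a≁y = λ i → proj₂ (linked (y∈S i))
                  ; x∼y = λ i → spoke∼ (y∈S i)
                  ; x≁y = λ i≢j → spoke≁ (y∈S _) (y∈S _) λ yⱼ≡yᵢ → i≢j (sym (y-injective yⱼ≡yᵢ))
                  ; x≁x = λ i j → independent (x i) (x j) (proj₁ (spoke-exclusive (y∈S i)))
                                                          (proj₁ (spoke-exclusive (y∈S j)))
                  ; y∼y = λ i≢j → S-adjacent (y∈S _) (y∈S _) (i≢j ∘ y-injective)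
                  }

                b-basic : Basic G (shape⇒⊑ G shape) b
                b-basic = shape-basic G shape (≢-sym a≢b) (adj-sym a≁b)
                            (λ i → proj₂ (spoke-exclusive (y∈S i))) (λ i → proj₁ (linked (y∈S i)))

              pyramid-over-S : Σ (Pyramid ⊑ G) λ Π → map Π apex ≡ a × Basic G Π b
              pyramid-over-S = case three-in-S of λ where
                (y , y-injective , y∈S) →
                  shape⇒⊑ G (shape y-injective y∈S) , refl , b-basic y-injective y∈S

            basic-pyramid : (∀ v → adj G a v ≡ true → OnInducedPath G a b v) →
              Σ (Pyramid ⊑ G) λ Π → map Π apex ≡ a × Basic G Π b
            basic-pyramid paths = case minimalDominating ⊤ (⊤-dominates paths) of λ where
              (S , S-dominates , S-private) → pyramid-over-S S-dominates S-private

lemma4p3 : (t : ℕ) → 2 ≤ t → {n : ℕ} → (G : Graph n) →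
    Free P₆ G → Free (K₂ t) G →
    (a b : Fin n) → adj G a b ≡ false → (a ≡ b → ⊥) →
    NeighbourhoodIndependent G a →
    DegreeAtLeast G a (3 * (t ∸ 1) + 1) →
    (∀ v → adj G a v ≡ true → OnInducedPath G a b v) →
    Σ (Pyramid ⊑ G) λ Π → (InducedEmb.map Π apex ≡ a) × Basic G Π b
-- The argument does not use the hypothesis 2 ≤ t.
lemma4p3 t _ G P₆-free K-free a b a≁b a≢b independent degree =
  Construction.basic-pyramid G independent K-free degree P₆-free a≁b a≢b
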